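{- Let $G=(V\cup\{v_0\},E)$ be a board with set of cells $V$, let $C$ be a set of colours, and let $W=\bigcup_{k\ge 1}W_k$ ($W_k\subset C^k$) be a set of prototiles which is $k$-sequentially permissive for every $k\in\{\deg(v)\mid v\in V\}$. If there exists a subset $U\subset V$ such that the restriction $G|_U$ is a board and the tiling problem $(G|_U,C,W)$ is always solvable, then the tiling problem $(G,C,W)$ is always solvable.
   Context: A board is a finite undirected (multi)graph $G=(V\cup\{v_0\},E)$ with a distinguished vertex $v_0$ (the constrainer) such that: for each $v\in V$ the set $N(v)$ of edges adjacent to $v$ is given a total order $N(v)=\{e_1(v),\dots,e_{\deg(v)}(v)\}$, where $\deg(v)$ is the degree of $v$; and the full subgraph on $V$ is (nonempty and) connected. Elements of $V$ are called cells. A tiling problem $(G,C,W)$ consists of a board $G$, a set of colours $C$, and a set of prototiles $W=\bigcup_{k\ge1}W_k$ with $W_k\subset C^k$. For $F\subset E$, a tiling of $F$ is a map $\tau:F\to C$ such that $(\tau(e_1(v)),\dots,\tau(e_{\deg(v)}(v)))\in W$ for every $v\in V$ with $N(v)\subset F$; it is full if $F=E$. A tiling $\tau':F'\to C$ extends $\tau:F\to C$ ($F\subset F'$) if $\tau'|_F=\tau$. Boundary constraints are maps $\beta:N(v_0)\to C$ (any such map is a tiling of $N(v_0)$). The problem $(G,C,W)$ is always solvable if every $\beta:N(v_0)\to C$ admits a full extension $\tau:E\to C$. For $U\subset V$, let $F$ be the edge set of the full subgraph of $G$ on $U$; the restriction $G|_U$ has vertex set $U\cup\{v_0\}$ and edge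 set $F\cup\{(u,v_0)\mid u\in U,\ (u,v)\in E\setminus F\}$ (each edge at $u\in U$ not in $F$ is replaced by an edge from $u$ to $v_0$, keeping its position in the ordering of $N(u)$). The set $W$ is $k$-sequentially permissive if for every $1\le i\le k$ the projection $\pi_{\bar i}:W_k\to C^{k-1}$ dropping the $i$-th coordinate is surjective. -}

module Defs where

open import Data.Nat using (ℕ; zero; suc)
open import Data.Fin using (Fin)
open import Data.Vec using (Vec; []; _∷_; removeAt; tabulate)
open import Data.Maybe using (Maybe; just; nothing)
open import Data.Bool using (Bool; true; false; T; _∨_)
open import Data.Bool.Properties using (T?)
open import Data.Unit using (⊤; tt)
open import Data.Empty using (⊥; ⊥-elim)
open import Data.Sum using (_⊎_; inj₁; inj₂)
open import Data.Product using (Σ; ∃; _×_; _,_; proj₁)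
open import Relation.Nullary using (yes; no; recompute)
open import Relation.Binary.PropositionalEquality using (_≡_; refl)
open import Relation.Binary.Construct.Closure.ReflexiveTransitive using (Star)
open import Function.Bundles using (_↔_)

-- A pre-board is the raw data of a finite multigraph with a distinguished
-- vertex v₀ (represented by `nothing`) and cells of type `Cell`
-- (represented by `just v`).  For each cell v,
-- `slot v : Fin (deg v) → Edge` is the total order e₁(v),…,e_deg(v)(v) of N(v).

record PreBoard : Set₁ where
  field
    Cell  : Set
    Edge  : Set
    end₁  : Edge → Maybe Cell
    end₂  : Edge → Maybe Cell
    deg   : Cell → ℕ
    slot  : (v : Cell) → Fin (deg v) → Edge
    slot-inc : ∀ v i → end₁ (slot v i) ≡ just v ⊎ end₂ (slot v i) ≡ just v

module _ (G : PreBoard) where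
  open PreBoard G

  Inc : Cell → Edge → Set
  Inc v e = end₁ e ≡ just v ⊎ end₂ e ≡ just v

  AtV₀ : Edge → Set
  AtV₀ e = end₁ e ≡ nothing ⊎ end₂ e ≡ nothing

  Adj : Cell → Cell → Set
  Adj u v = ∃ λ e → (end₁ e ≡ just u × end₂ e ≡ just v)
                   ⊎ (end₁ e ≡ just v × end₂ e ≡ just u)

  record IsBoard : Set where
    field
      cells-finite : ∃ λ n → Cell ↔ Fin n
      edges-finite : ∃ λ m → Edge ↔ Fin m
      slot-inj  : ∀ v i j → slot v i ≡ slot v j → i ≡ j
      slot-surj : ∀ v e → Inc v e → ∃ λ i → slot v i ≡ e
      nonempty  : Cell
      connected : ∀ u v → Star Adj u v

-- Prototiles: W k' ⊆ C^(suc k'), i.e. W = ⋃_{k ≥ 1} W_k.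

Prototiles : Set → Set₁
Prototiles C = (k : ℕ) → Vec C (suc k) → Set

_∈W_ : {C : Set} {k : ℕ} → Vec C k → Prototiles C → Set
[]       ∈W W = ⊥
(c ∷ cs) ∈W W = W _ (c ∷ cs)

SeqPermissive : {C : Set} → Prototiles C → ℕ → Set
SeqPermissive W zero    = ⊤
SeqPermissive {C} W (suc k) =
  (i : Fin (suc k)) (x : Vec C k) → ∃ λ w → W k w × removeAt w i ≡ x

module _ (G : PreBoard) {C : Set} (W : Prototiles C) where
  open PreBoard G

  IsFullTiling : (Edge → C) → Set
  IsFullTiling τ = ∀ v → tabulate (λ i → τ (slot v i)) ∈W W

  -- every boundary constraint β : N(v₀) → C admits a full extension.
  -- (β is given as a function on all edges; only its values on N(v₀) matter.)
  AlwaysSolvable : Set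
  AlwaysSolvable = (β : Edge → C) →
    ∃ λ τ → (∀ e → AtV₀ G e → τ e ≡ β e) × IsFullTiling τ

module _ (G : PreBoard) (U : PreBoard.Cell G → Bool) where
  open PreBoard G

  inU : Maybe Cell → Bool
  inU nothing  = false
  inU (just v) = U v

  touches : Edge → Bool
  touches e = inU (end₁ e) ∨ inU (end₂ e)

  record RCell : Set where
    constructor ⟨_,_⟩
    field
      cell  : Cell
      .inU' : T (U cell)

  REdge : Set
  REdge = Σ Edge (λ e → T (touches e))

  -- an endpoint outside U is replaced by v₀
  restrictEnd : Maybe Cell → Maybe RCell
  restrictEnd nothing = nothing
  restrictEnd (just v) with T? (U v)
  ... | yes p = just ⟨ v , p ⟩
  ... | no  _ = nothing

  private
    T-∨ˡ : ∀ a b → T a → T (a ∨ b)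
    T-∨ˡ true b _ = tt

    T-∨ʳ : ∀ a b → T b → T (a ∨ b)
    T-∨ʳ true  b _ = tt
    T-∨ʳ false b p = p

  inc-touches : ∀ v e → T (U v) → end₁ e ≡ just v ⊎ end₂ e ≡ just v → T (touches e)
  inc-touches v e p (inj₁ q) with end₁ e
  inc-touches v e p (inj₁ refl) | .(just v) = T-∨ˡ (U v) _ p
  inc-touches v e p (inj₂ q) with end₂ e
  inc-touches v e p (inj₂ refl) | .(just v) = T-∨ʳ (inU (end₁ e)) (U v) p

  restrictEnd-in : ∀ v → .(p : T (U v)) → restrictEnd (just v) ≡ just ⟨ v , p ⟩
  restrictEnd-in v p with T? (U v)
  ... | yes q = refl
  ... | no ¬q = ⊥-elim (¬q (recompute (T? (U v)) p))

  restrict-inc : ∀ v (p : T (U v)) e → end₁ e ≡ just v ⊎ end₂ e ≡ just v →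
    restrictEnd (end₁ e) ≡ just ⟨ v , p ⟩ ⊎ restrictEnd (end₂ e) ≡ just ⟨ v , p ⟩
  restrict-inc v p e (inj₁ q) rewrite q = inj₁ (restrictEnd-in v p)
  restrict-inc v p e (inj₂ q) rewrite q = inj₂ (restrictEnd-in v p)

  restrict : PreBoard
  restrict = record
    { Cell = RCell
    ; Edge = REdge
    ; end₁ = λ e → restrictEnd (end₁ (proj₁ e))
    ; end₂ = λ e → restrictEnd (end₂ (proj₁ e))
    ; deg  = λ v → deg (RCell.cell v)
    ; slot = λ { ⟨ v , p ⟩ i → slot v i
                   , inc-touches v (slot v i) (recompute (T? (U v)) p) (slot-inc v i) }
    ; slot-inc = λ { ⟨ v , p ⟩ i → restrict-inc v (recompute (T? (U v)) p)
                                     (slot v i) (slot-inc v i) }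
    }

-- Call U ⊆ V "solvable" if every boundary condition on the edges not inside U
-- extends to a tiling that is valid at every cell of U.  The restriction
-- hypothesis says exactly that U itself is solvable.  A solvable region grows
-- by any neighbouring cell v: permissiveness at v yields a colour c for the
-- edge joining v to the region such that v is tiled whatever the other edges
-- at v carry; prescribing c on that edge and solving the smaller region
-- leaves all other edges at v at their boundary values.  Since the board is
-- connected and finite, the region grows to all of V, and solvability of V
-- is the theorem.
module Submission where

open import Defs
open import Data.Bool using (Bool; T; _∨_; if_then_else_)
open import Data.Bool.Properties using (T?; T-∨; T-irrelevant)
open import Data.Empty using (⊥-elim)
open import Data.Fin using (Fin; zero; suc; punchOut; _≟_)
open import Data.Maybe using (just; nothing)
open import Data.Nat using (zero; suc)
open import Data.Product using (∃; _×_; _,_; proj₁)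
open import Data.Sum using (_⊎_; inj₁; inj₂; map₂)
open import Data.Vec using (Vec; removeAt; tabulate; lookup)
open import Data.Vec.Properties using (removeAt-punchOut; tabulate-cong; tabulate∘lookup; lookup∘tabulate)
open import Function using (id; _∘_; Equivalence; Inverse; _↔_)
open import Function.Properties.Inverse using (↔⇒↣)
open import Relation.Binary.Definitions using (DecidableEquality)
open import Relation.Binary.PropositionalEquality using (_≡_; _≢_; refl; sym; trans; cong; subst; module ≡-Reasoning)
open import Relation.Binary.Construct.Closure.ReflexiveTransitive using (Star; ε; _◅_)
open import Relation.Nullary using (¬_; yes; no; does; recompute)
open import Relation.Nullary.Decidable using (⌊_⌋; via-injection; dec-true; dec-false; toWitness; fromWitness)

removeAt≡⇒lookup≡ : ∀ {A : Set} {n} {xs ys : Vec A (suc n)} {i j : Fin (suc n)} →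
  removeAt xs i ≡ removeAt ys i → i ≢ j → lookup xs j ≡ lookup ys j
removeAt≡⇒lookup≡ {xs = xs} {ys} {i} {j} eq i≢j = begin
  lookup xs j                           ≡⟨ removeAt-punchOut xs i≢j ⟨
  lookup (removeAt xs i) (punchOut i≢j) ≡⟨ cong (λ zs → lookup zs (punchOut i≢j)) eq ⟩
  lookup (removeAt ys i) (punchOut i≢j) ≡⟨ removeAt-punchOut ys i≢j ⟩
  lookup ys j                           ∎
  where open ≡-Reasoning

SeqPermissive⇒fillable : ∀ {C : Set} {W : Prototiles C} {n} → SeqPermissive W n →
  (i : Fin n) (f : Fin n → C) →
  ∃ λ c → ∀ g → g i ≡ c → (∀ j → i ≢ j → g j ≡ f j) → tabulate g ∈W W
SeqPermissive⇒fillable {W = W} {suc k} perm i f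
  with w , w∈W , removeAt-w≡ ← perm i (removeAt (tabulate f) i) =
  lookup w i , λ g gi≡c g≡f → subst (W k) (sym (tabulate≡w g gi≡c g≡f)) w∈W
  where
  tabulate≡w : ∀ g → g i ≡ lookup w i → (∀ j → i ≢ j → g j ≡ f j) → tabulate g ≡ w
  tabulate≡w g gi≡c g≡f = trans (tabulate-cong g≗w) (tabulate∘lookup w)
    where
    g≗w : ∀ j → g j ≡ lookup w j
    g≗w j with i ≟ j
    ... | yes refl = gi≡c
    ... | no i≢j   = begin
      g j                   ≡⟨ g≡f j i≢j ⟩
      f j                   ≡⟨ lookup∘tabulate f j ⟨
      lookup (tabulate f) j ≡⟨ removeAt≡⇒lookup≡ {xs = tabulate f} {ys = w} (sym removeAt-w≡) i≢j ⟩
      lookup w j            ∎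
      where open ≡-Reasoning

↔Fin⇒decidableEquality : ∀ {A : Set} → (∃ λ n → A ↔ Fin n) → DecidableEquality A
↔Fin⇒decidableEquality (_ , A↔Fin) = via-injection (↔⇒↣ A↔Fin) _≟_

module Regions (G : PreBoard) {C : Set} (W : Prototiles C) where
  open PreBoard G

  Region : Set
  Region = Cell → Bool

  _⊆_ : Region → Region → Set
  U ⊆ U′ = ∀ {v} → T (U v) → T (U′ v)

  Inside : Region → Edge → Set
  Inside U e = T (inU G U (end₁ e)) × T (inU G U (end₂ e))

  Inside-mono : ∀ {U U′} → U ⊆ U′ → ∀ {e} → Inside U e → Inside U′ e
  Inside-mono {U} {U′} U⊆U′ {e} (p₁ , p₂) = mono (end₁ e) p₁ , mono (end₂ e) p₂
    where
    mono : ∀ x → T (inU G U x) → T (inU G U′ x)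
    mono (just v) = U⊆U′

  Joins : Cell → Cell → Edge → Set
  Joins a v e = (end₁ e ≡ just a × end₂ e ≡ just v) ⊎ (end₁ e ≡ just v × end₂ e ≡ just a)

  Joins⇒Inc : ∀ {a v e} → Joins a v e → Inc G v e
  Joins⇒Inc (inj₁ (_ , q)) = inj₂ q
  Joins⇒Inc (inj₂ (q , _)) = inj₁ q

  Joins⇒Inside : ∀ {U a v e} → Joins a v e → T (U a) → T (U v) → Inside U e
  Joins⇒Inside {U} (inj₁ (p , q)) a∈U v∈U =
    subst (T ∘ inU G U) (sym p) a∈U , subst (T ∘ inU G U) (sym q) v∈U
  Joins⇒Inside {U} (inj₂ (p , q)) a∈U v∈U =
    subst (T ∘ inU G U) (sym p) v∈U , subst (T ∘ inU G U) (sym q) a∈U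

  Tiled : (Edge → C) → Cell → Set
  Tiled τ v = tabulate (λ i → τ (slot v i)) ∈W W

  SolvableOn : Region → Set
  SolvableOn U = (β : Edge → C) →
    ∃ λ τ → (∀ e → ¬ Inside U e → τ e ≡ β e) × (∀ v → T (U v) → Tiled τ v)

  SolvableOn-full⇒AlwaysSolvable : ∀ {U} → (∀ v → T (U v)) → SolvableOn U → AlwaysSolvable G W
  SolvableOn-full⇒AlwaysSolvable {U} full S β with τ , agrees , tiled ← S β =
    τ , (λ e e∈N[v₀] → agrees e (v₀-outside e∈N[v₀])) , (λ v → tiled v (full v))
    where
    v₀-outside : ∀ {e} → AtV₀ G e → ¬ Inside U e
    v₀-outside (inj₁ q) (p , _) = subst (T ∘ inU G U) q p
    v₀-outside (inj₂ q) (_ , p) = subst (T ∘ inU G U) q p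

  module _ (U : Region) where

    restrictEnd-outside : ∀ x → ¬ T (inU G U x) → restrictEnd G U x ≡ nothing
    restrictEnd-outside nothing  _   = refl
    restrictEnd-outside (just v) v∉U with T? (U v)
    ... | yes v∈U = ⊥-elim (v∉U v∈U)
    ... | no  _   = refl

    ¬Inside⇒AtV₀ : ∀ {e} (p : T (touches G U e)) → ¬ Inside U e → AtV₀ (restrict G U) (e , p)
    ¬Inside⇒AtV₀ {e} _ ¬inside with T? (inU G U (end₁ e)) | T? (inU G U (end₂ e))
    ... | no  ∉₁ | _      = inj₁ (restrictEnd-outside (end₁ e) ∉₁)
    ... | yes _  | no ∉₂  = inj₂ (restrictEnd-outside (end₂ e) ∉₂)
    ... | yes ∈₁ | yes ∈₂ = ⊥-elim (¬inside (∈₁ , ∈₂))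

    AlwaysSolvable-restrict⇒SolvableOn : AlwaysSolvable (restrict G U) W → SolvableOn U
    AlwaysSolvable-restrict⇒SolvableOn AS β
      with τ′ , agrees′ , tiled′ ← AS (β ∘ proj₁) = τ , agrees , tiled
      where
      τ : Edge → C
      τ e with T? (touches G U e)
      ... | yes p = τ′ (e , p)
      ... | no  _ = β e

      τ-touching : ∀ e p → τ e ≡ τ′ (e , p)
      τ-touching e p with T? (touches G U e)
      ... | yes q = cong (λ q → τ′ (e , q)) (T-irrelevant q p)
      ... | no ¬p = ⊥-elim (¬p p)

      agrees : ∀ e → ¬ Inside U e → τ e ≡ β e
      agrees e ¬inside with T? (touches G U e)
      ... | yes p = agrees′ (e , p) (¬Inside⇒AtV₀ p ¬inside)
      ... | no  _ = refl

      tiled : ∀ v → T (U v) → Tiled τ v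
      tiled v v∈U = subst (_∈W W) (tabulate-cong (λ i → sym (τ-touching (slot v i) _)))
                      (tiled′ ⟨ v , v∈U ⟩)

  module Growth (BG : IsBoard G) (perm : ∀ v → SeqPermissive W (deg v)) where
    open IsBoard BG

    _≟ᶜ_ : DecidableEquality Cell
    _≟ᶜ_ = ↔Fin⇒decidableEquality cells-finite

    _≟ᵉ_ : DecidableEquality Edge
    _≟ᵉ_ = ↔Fin⇒decidableEquality edges-finite

    _∪｛_｝ : Region → Cell → Region
    (U ∪｛ v ｝) w = U w ∨ ⌊ w ≟ᶜ v ⌋

    ∪-inj₁ : ∀ {U v} → U ⊆ (U ∪｛ v ｝)
    ∪-inj₁ p = Equivalence.from T-∨ (inj₁ p)

    ∪-self : ∀ {U v} → T ((U ∪｛ v ｝) v)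
    ∪-self {v = v} = Equivalence.from T-∨ (inj₂ (fromWitness {a? = v ≟ᶜ v} refl))

    ∪-elim : ∀ {U v w} → T ((U ∪｛ v ｝) w) → T (U w) ⊎ w ≡ v
    ∪-elim {v = v} {w} p = map₂ (toWitness {a? = w ≟ᶜ v}) (Equivalence.to T-∨ p)

    _[_≔_] : (Edge → C) → Edge → C → Edge → C
    (β [ e ≔ c ]) e′ = if does (e′ ≟ᵉ e) then c else β e′

    []≔-updates : ∀ β e c → (β [ e ≔ c ]) e ≡ c
    []≔-updates β e c = cong (if_then c else β e) (dec-true (e ≟ᵉ e) refl)

    []≔-minimal : ∀ β {e e′} c → e′ ≢ e → (β [ e ≔ c ]) e′ ≡ β e′
    []≔-minimal β {e} {e′} c e′≢e = cong (if_then c else β e′) (dec-false (e′ ≟ᵉ e) e′≢e)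

    SolvableOn-∪ : ∀ {U a v} → SolvableOn U → Adj G a v → T (U a) → ¬ T (U v) →
                   SolvableOn (U ∪｛ v ｝)
    SolvableOn-∪ {U} {a} {v} S (e , ends) a∈U v∉U β
      with i , slot-i≡e ← slot-surj v e (Joins⇒Inc ends)
      with c , fill ← SeqPermissive⇒fillable (perm v) i (λ j → β (slot v j))
      with τ , agrees , tiled ← S (β [ e ≔ c ]) = τ , agrees⁺ , tiled⁺
      where
      slot-outside : ∀ j → ¬ Inside U (slot v j)
      slot-outside j (p₁ , p₂) with slot-inc v j
      ... | inj₁ q = v∉U (subst (T ∘ inU G U) q p₁)
      ... | inj₂ q = v∉U (subst (T ∘ inU G U) q p₂)

      τ-at-v : ∀ j → τ (slot v j) ≡ (β [ e ≔ c ]) (slot v j)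
      τ-at-v j = agrees (slot v j) (slot-outside j)

      tiled-v : Tiled τ v
      tiled-v = fill (λ j → τ (slot v j))
        (trans (τ-at-v i) (trans (cong (β [ e ≔ c ]) slot-i≡e) ([]≔-updates β e c)))
        (λ j i≢j → trans (τ-at-v j)
          ([]≔-minimal β c (λ slot-j≡e → i≢j (slot-inj v i j (trans slot-i≡e (sym slot-j≡e))))))

      agrees⁺ : ∀ e′ → ¬ Inside (U ∪｛ v ｝) e′ → τ e′ ≡ β e′
      agrees⁺ e′ ¬inside = trans (agrees e′ (¬inside ∘ Inside-mono (∪-inj₁ {U} {v})))
        ([]≔-minimal β c λ { refl → ¬inside (Joins⇒Inside ends (∪-inj₁ {U} {v} a∈U) (∪-self {U})) })

      tiled⁺ : ∀ w → T ((U ∪｛ v ｝) w) → Tiled τ w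
      tiled⁺ w w∈ with ∪-elim {U} w∈
      ... | inj₁ w∈U = tiled w w∈U
      ... | inj₂ refl = tiled-v

    SolvableOn-reach : ∀ {U u w} → SolvableOn U → T (U u) → Star (Adj G) u w →
                       ∃ λ U′ → U ⊆ U′ × T (U′ w) × SolvableOn U′
    SolvableOn-reach S u∈U ε = _ , id , u∈U , S
    SolvableOn-reach {U} S u∈U (_◅_ {j = y} adj path) with T? (U y)
    ... | yes y∈U = SolvableOn-reach S y∈U path
    ... | no  y∉U
      with U′ , U∪y⊆U′ , w∈U′ , S′
             ← SolvableOn-reach (SolvableOn-∪ S adj u∈U y∉U) (∪-self {U}) path =
      U′ , U∪y⊆U′ ∘ ∪-inj₁ {U} {y} , w∈U′ , S′

    SolvableOn-cover : ∀ {U u n} → SolvableOn U → T (U u) → (f : Fin n → Cell) →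
                       ∃ λ U′ → U ⊆ U′ × (∀ i → T (U′ (f i))) × SolvableOn U′
    SolvableOn-cover {n = zero} S u∈U f = _ , id , (λ ()) , S
    SolvableOn-cover {n = suc n} S u∈U f
      with U₁ , U⊆U₁ , f∘suc⊆U₁ , S₁ ← SolvableOn-cover S u∈U (f ∘ suc)
      with U₂ , U₁⊆U₂ , f0∈U₂ , S₂ ← SolvableOn-reach S₁ (U⊆U₁ u∈U) (connected _ (f zero)) =
      U₂ , U₁⊆U₂ ∘ U⊆U₁ , (λ { zero → f0∈U₂ ; (suc i) → U₁⊆U₂ (f∘suc⊆U₁ i) }) , S₂

    SolvableOn⇒AlwaysSolvable : ∀ {U u} → SolvableOn U → T (U u) → AlwaysSolvable G W
    SolvableOn⇒AlwaysSolvable S u∈U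
      with _ , Cell↔Fin ← cells-finite
      with U′ , _ , enum⊆U′ , S′ ← SolvableOn-cover S u∈U (Inverse.from Cell↔Fin) =
      SolvableOn-full⇒AlwaysSolvable
        (λ v → subst (T ∘ U′) (Inverse.strictlyInverseʳ Cell↔Fin v)
                              (enum⊆U′ (Inverse.to Cell↔Fin v)))
        S′

restrict-nonempty : ∀ {G U} → IsBoard (restrict G U) → ∃ λ u → T (U u)
restrict-nonempty {U = U} BU with ⟨ u , u∈U ⟩ ← IsBoard.nonempty BU = u , recompute (T? (U u)) u∈U

lemma1 : (G : PreBoard) → IsBoard G →
    (C : Set) (W : Prototiles C) →
    (∀ v → SeqPermissive W (PreBoard.deg G v)) →
    (U : PreBoard.Cell G → Bool) →
    IsBoard (restrict G U) →
    AlwaysSolvable (restrict G U) W →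
    AlwaysSolvable G W
lemma1 G BG _ W perm U BU AS with _ , u∈U ← restrict-nonempty BU =
  SolvableOn⇒AlwaysSolvable (AlwaysSolvable-restrict⇒SolvableOn U AS) u∈U
  where
  open Regions G W
  open Growth BG perm
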